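{- Let $G$ be a connected graph and let $W$ be its annular subgraph. If $W$ is non-null and connected, then $\mathrm{rad}(W)\ge 2$, and consequently $|A(G)|\ge 4$.
   Context: All graphs are finite and simple. For a connected graph $G$, the eccentricity of a vertex $v$ is $e(v)=\max\{d(v,u): u\in V(G)\}$; $\mathrm{rad}(G)$ and $\mathrm{diam}(G)$ are the minimum and maximum eccentricities. The annulus $A(G)$ is the set of vertices $w$ with $\mathrm{rad}(G)<e(w)<\mathrm{diam}(G)$, and the annular subgraph $W$ is the subgraph of $G$ induced by $A(G)$; its radius is computed with distances in $W$. A graph is null if it has no vertices. -}

module Defs where

open import Level using (0ℓ)
open import Data.Nat using (ℕ; zero; suc; _≤_; _<_)
open import Data.Fin using (Fin)
open import Data.Fin.Subset using (Subset; _∈_)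
open import Data.Product using (Σ; ∃; _×_; _,_; proj₁)
open import Relation.Nullary using (¬_; Dec)
open import Relation.Binary.PropositionalEquality using (_≡_)

record Graph (V : Set) : Set₁ where
  field
    Adj    : V → V → Set
    adj?   : ∀ u v → Dec (Adj u v)
    sym    : ∀ {u v} → Adj u v → Adj v u
    irrefl : ∀ {u} → ¬ Adj u u
open Graph public

FinGraph : ℕ → Set₁
FinGraph n = Graph (Fin n)

module _ {V : Set} (G : Graph V) where

  data Walk : V → V → ℕ → Set where
    here : ∀ {u} → Walk u u zero
    step : ∀ {u v w k} → Adj G u v → Walk v w k → Walk u w (suc k)

  Connected : Set
  Connected = ∀ u v → ∃ λ k → Walk u v k

  IsDist : V → V → ℕ → Set
  IsDist u v d = Walk u v d × (∀ k → Walk u v k → d ≤ k)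

  IsEcc : V → ℕ → Set
  IsEcc v e = (∀ u d → IsDist v u d → d ≤ e) × (∃ λ u → IsDist v u e)

  IsRad : ℕ → Set
  IsRad r = (∃ λ v → IsEcc v r) × (∀ v e → IsEcc v e → r ≤ e)

  IsDiam : ℕ → Set
  IsDiam D = (∃ λ v → IsEcc v D) × (∀ v e → IsEcc v e → e ≤ D)

  InAnnulus : V → Set
  InAnnulus w = ∃ λ r → ∃ λ D → ∃ λ e →
    IsRad r × IsDiam D × IsEcc w e × r < e × e < D

Induced : ∀ {n} → FinGraph n → (S : Subset n) → Graph (Σ (Fin n) (λ x → x ∈ S))
Induced G S = record
  { Adj    = λ a b → Adj G (proj₁ a) (proj₁ b)
  ; adj?   = λ a b → adj? G (proj₁ a) (proj₁ b)
  ; sym    = sym G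
  ; irrefl = irrefl G
  }

-- Every annular vertex w has an annular vertex at distance at least 2.  Take u with
-- d(w,u) = e(w) and walk from a central vertex c to u along a shortest path.  Since
-- eccentricities of adjacent vertices differ by at most one, either e(u) ≤ rad(G), which
-- contradicts d(w,u) = e(w) > rad(G), or the walk meets a first vertex y with
-- e(y) = rad(G) + 1 ≤ e(w) < diam(G), so y is annular, and d(y,u) < d(c,u) ≤ rad(G);
-- then d(w,y) ≤ 1 would give d(w,u) ≤ rad(G).  Consequently no vertex of W dominates W,
-- so rad(W) ≥ 2, and a shortest path in W between non-adjacent vertices, together with a
-- non-neighbour of its middle vertex when it has length 2, yields four annular vertices.

module Submission where

open import Defs
open import Level using (0ℓ)
open import Data.Nat using (ℕ; zero; suc; _+_; _≤_; _<_; z≤n; s≤s; _≤?_)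
open import Data.Nat.Properties
open import Data.Nat.Induction using (<-rec)
open import Data.Fin using (Fin) renaming (_≟_ to _≟ᶠ_)
open import Data.Fin.Properties using (any?)
open import Data.Fin.Subset using (Subset; _∈_; _-_; ∣_∣)
open import Data.Fin.Subset.Properties using (_∈?_; x∈p∧x≢y⇒x∈p-y; x∈p⇒∣p-x∣<∣p∣)
open import Data.List using (List; []; _∷_; length; allFin)
open import Data.List.Properties using (length-map)
open import Data.List.Relation.Unary.All as All using (All; []; _∷_)
import Data.List.Relation.Unary.All.Properties as Allₚ
open import Data.List.Relation.Unary.AllPairs using ([]; _∷_)
open import Data.List.Relation.Unary.Unique.Propositional using (Unique)
import Data.List.Relation.Unary.Unique.Propositional.Properties as Unique
open import Data.List.Membership.Propositional.Properties using (∈-allFin)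
open import Data.List.Extrema.Nat using (argmax; f[xs]≤f[argmax])
open import Data.Vec.Properties.WithK using ([]=-irrelevant)
open import Data.Product using (Σ; ∃; _×_; _,_; proj₁; proj₂)
open import Data.Product.Properties using (≡-dec)
open import Data.Sum as Sum using (_⊎_; inj₁; inj₂)
open import Data.Empty using (⊥; ⊥-elim)
open import Function using (_∘_)
open import Function.Bundles using (_⇔_; Equivalence)
open import Relation.Nullary using (¬_; Dec; yes; no)
open import Relation.Nullary.Decidable as Dec using (_×-dec_)
open import Relation.Unary using (Pred; Decidable)
open import Relation.Binary.Definitions using (DecidableEquality)
open import Relation.Binary.PropositionalEquality
  using (_≡_; _≢_; refl; cong; subst; ≢-sym) renaming (sym to ≡-sym)

least : ∀ {P : Pred ℕ 0ℓ} → Decidable P → ∀ {n} → P n →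
        ∃ λ m → P m × (∀ k → P k → m ≤ k)
least {P} P? = <-rec _ go _
  where
  Least : Set
  Least = ∃ λ m → P m × (∀ k → P k → m ≤ k)

  go : ∀ n → (∀ {m} → m < n → P m → Least) → P n → Least
  go n rec pn with anyUpTo? P? n
  ... | yes (m , m<n , pm) = rec m<n pm
  ... | no none = n , pn , λ k pk → ≮⇒≥ λ k<n → none (k , k<n , pk)

Exhaustible : Set → Set₁
Exhaustible V = ∀ {P : Pred V 0ℓ} → Decidable P → Dec (∃ P)

Unique⇒length≤∣p∣ : ∀ {n} {p : Subset n} {xs : List (Fin n)} →
                    Unique xs → All (_∈ p) xs → length xs ≤ ∣ p ∣
Unique⇒length≤∣p∣ {xs = []} [] [] = z≤n
Unique⇒length≤∣p∣ {p = p} {xs = x ∷ xs} (x∉xs ∷ unique) (x∈p ∷ xs⊆p) = begin-strict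
  length xs  ≤⟨ Unique⇒length≤∣p∣ unique xs⊆p-x ⟩
  ∣ p - x ∣  <⟨ x∈p⇒∣p-x∣<∣p∣ x∈p ⟩
  ∣ p ∣      ∎
  where
  open ≤-Reasoning
  xs⊆p-x : All (_∈ p - x) xs
  xs⊆p-x = All.zipWith (λ (y∈p , x≢y) → x∈p∧x≢y⇒x∈p-y y∈p (≢-sym x≢y)) (xs⊆p , x∉xs)

module _ {n} {p : Subset n} where

  ∈-irrelevant : ∀ {x} (u v : x ∈ p) → u ≡ v
  ∈-irrelevant = []=-irrelevant

  member-injective : ∀ {a b : Σ (Fin n) (_∈ p)} → proj₁ a ≡ proj₁ b → a ≡ b
  member-injective {x , u} {.x , v} refl = cong (x ,_) (∈-irrelevant u v)

  member-≟ : DecidableEquality (Σ (Fin n) (_∈ p))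
  member-≟ = ≡-dec _≟ᶠ_ λ u v → yes (∈-irrelevant u v)

  member-exhaustible : Exhaustible (Σ (Fin n) (_∈ p))
  member-exhaustible {P} P? =
    Dec.map′ (λ (x , u , px) → (x , u) , px) (λ ((x , u) , px) → x , u , px) (any? P∈?)
    where
    P∈? : ∀ x → Dec (Σ (x ∈ p) λ u → P (x , u))
    P∈? x with x ∈? p
    ... | no x∉p = no (x∉p ∘ proj₁)
    ... | yes u = Dec.map′ (u ,_) (λ (v , pv) → subst (λ v → P (x , v)) (∈-irrelevant v u) pv)
                           (P? (x , u))

  members-length≤∣p∣ : ∀ {xs : List (Σ (Fin n) (_∈ p))} → Unique xs → length xs ≤ ∣ p ∣
  members-length≤∣p∣ {xs} unique = subst (_≤ ∣ p ∣) (length-map proj₁ xs)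
    (Unique⇒length≤∣p∣ (Unique.map⁺ member-injective unique) (Allₚ.map⁺ (All.universal proj₂ xs)))

module _ {V : Set} (G : Graph V) where

  walk-snoc : ∀ {x y z k} → Walk G x y k → Adj G y z → Walk G x z (suc k)
  walk-snoc here       b = step b here
  walk-snoc (step a w) b = step a (walk-snoc w b)

  walk-reverse : ∀ {x y k} → Walk G x y k → Walk G y x k
  walk-reverse here       = here
  walk-reverse (step a w) = walk-snoc (walk-reverse w) (sym G a)

  walk-++ : ∀ {x y z k l} → Walk G x y k → Walk G y z l → Walk G x z (k + l)
  walk-++ here       w = w
  walk-++ (step a v) w = step a (walk-++ v w)

  adjacent⇒≢ : ∀ {x y} → Adj G x y → x ≢ y
  adjacent⇒≢ a refl = irrefl G a

  NonNeighbour : V → V → Set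
  NonNeighbour x y = x ≢ y × ¬ Adj G x y

  nonNeighbour⇒2≤length : ∀ {x y k} → NonNeighbour x y → Walk G x y k → 2 ≤ k
  nonNeighbour⇒2≤length (x≢y , _) here              = ⊥-elim (x≢y refl)
  nonNeighbour⇒2≤length (_ , ¬a)  (step a here)     = ⊥-elim (¬a a)
  nonNeighbour⇒2≤length _         (step _ (step _ _)) = s≤s (s≤s z≤n)

  shortest-no-shortcut : ∀ {x y v L i j} → IsDist G x y L →
                         Walk G x v i → Walk G v y j → i + j < L → ⊥
  shortest-no-shortcut (_ , minimal) u w i+j<L = <⇒≱ i+j<L (minimal _ (walk-++ u w))

module ShortestWalks {V : Set} (G : Graph V)
                     (_≟_ : DecidableEquality V) (exhaustible : Exhaustible V) where

  walk? : ∀ u v k → Dec (Walk G u v k)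
  walk? u v zero    = Dec.map′ (λ { refl → here }) (λ { here → refl }) (u ≟ v)
  walk? u v (suc k) =
    Dec.map′ (λ (x , a , w) → step a w) (λ { (step a w) → _ , a , w })
             (exhaustible λ x → adj? G u x ×-dec walk? x v k)

  shortest : ∀ {u v k} → Walk G u v k → ∃ (IsDist G u v)
  shortest = least (walk? _ _)

module Metric {n} (G : FinGraph n) (connected : Connected G) where

  open ShortestWalks G _≟ᶠ_ any?

  dist : Fin n → Fin n → ℕ
  dist x y = proj₁ (shortest (proj₂ (connected x y)))

  dist-isDist : ∀ x y → IsDist G x y (dist x y)
  dist-isDist x y = proj₂ (shortest (proj₂ (connected x y)))

  dist≤length : ∀ {x y k} → Walk G x y k → dist x y ≤ k
  dist≤length w = proj₂ (dist-isDist _ _) _ w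

  dist-walk : ∀ x y → Walk G x y (dist x y)
  dist-walk x y = proj₁ (dist-isDist x y)

  isDist⇒≡dist : ∀ {x y d} → IsDist G x y d → d ≡ dist x y
  isDist⇒≡dist (w , minimal) = ≤-antisym (minimal _ (dist-walk _ _)) (dist≤length w)

  dist-sym : ∀ x y → dist x y ≤ dist y x
  dist-sym x y = dist≤length (walk-reverse G (dist-walk y x))

  dist-triangle : ∀ x y z → dist x z ≤ dist x y + dist y z
  dist-triangle x y z = dist≤length (walk-++ G (dist-walk x y) (dist-walk y z))

  dist-adjacent : ∀ {x y} → Adj G x y → dist x y ≤ 1
  dist-adjacent a = dist≤length (step a here)

  farthest : Fin n → Fin n
  farthest x = argmax (dist x) x (allFin n)

  ecc : Fin n → ℕ
  ecc x = dist x (farthest x)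

  dist≤ecc : ∀ x y → dist x y ≤ ecc x
  dist≤ecc x y = All.lookup (f[xs]≤f[argmax] x (allFin n)) (∈-allFin y)

  ecc-isEcc : ∀ x → IsEcc G x (ecc x)
  ecc-isEcc x = (λ y d d-isDist → subst (_≤ ecc x) (≡-sym (isDist⇒≡dist d-isDist)) (dist≤ecc x y))
              , farthest x , dist-isDist x (farthest x)

  isEcc⇒≡ecc : ∀ {x e} → IsEcc G x e → e ≡ ecc x
  isEcc⇒≡ecc {x} (bounded , y , e-isDist) =
    ≤-antisym (subst (_≤ ecc x) (≡-sym (isDist⇒≡dist e-isDist)) (dist≤ecc x y))
              (bounded _ _ (dist-isDist x (farthest x)))

  ecc-adjacent : ∀ {x y} → Adj G x y → ecc y ≤ suc (ecc x)
  ecc-adjacent {x} {y} a = begin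
    ecc y                                ≤⟨ dist-triangle y x (farthest y) ⟩
    dist y x + dist x (farthest y)       ≤⟨ +-mono-≤ (dist-adjacent (sym G a)) (dist≤ecc x _) ⟩
    suc (ecc x)                          ∎
    where open ≤-Reasoning

  ecc-crossing : ∀ {x u L r} → Walk G x u L → ecc x ≤ r →
                 ecc u ≤ r ⊎ ∃ λ y → ecc y ≡ suc r × dist y u < L
  ecc-crossing here ex≤r = inj₁ ex≤r
  ecc-crossing {x} {u} {_} {r} (step {v = y} {k = k} a w) ex≤r = continue (ecc y ≤? r)
    where
    continue : Dec (ecc y ≤ r) → ecc u ≤ r ⊎ ∃ λ z → ecc z ≡ suc r × dist z u < suc k
    continue (yes ey≤r) =
      Sum.map₂ (λ (z , ez , dzu<L) → z , ez , m≤n⇒m≤1+n dzu<L) (ecc-crossing w ey≤r)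
    continue (no ey≰r) =
      inj₂ (y , ≤-antisym (≤-trans (ecc-adjacent {x} {y} a) (s≤s ex≤r)) (≰⇒> ey≰r)
              , s≤s (dist≤length w))

  nonNeighbour-beyond-radius : ∀ {r w} → IsRad G r → r < ecc w →
                               ∃ λ y → ecc y ≡ suc r × NonNeighbour G w y
  nonNeighbour-beyond-radius {r} {w} ((c , c-isEcc) , _) r<ecc =
    conclude (ecc-crossing (dist-walk c u) (≤-reflexive (≡-sym r≡ecc-c)))
    where
    u = farthest w
    r≡ecc-c = isEcc⇒≡ecc c-isEcc

    near : ∀ {y} → dist y u < dist c u → dist w y ≤ 1 → ⊥
    near {y} dyu<dcu dwy≤1 = <⇒≱ r<ecc (begin
      ecc w                ≤⟨ dist-triangle w y u ⟩
      dist w y + dist y u  ≤⟨ +-monoˡ-≤ (dist y u) dwy≤1 ⟩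
      suc (dist y u)       ≤⟨ dyu<dcu ⟩
      dist c u             ≤⟨ dist≤ecc c u ⟩
      ecc c                ≡⟨ ≡-sym r≡ecc-c ⟩
      r                    ∎)
      where open ≤-Reasoning

    conclude : ecc u ≤ r ⊎ (∃ λ y → ecc y ≡ suc r × dist y u < dist c u) →
               ∃ λ y → ecc y ≡ suc r × NonNeighbour G w y
    conclude (inj₁ eu≤r) =
      ⊥-elim (<⇒≱ r<ecc (≤-trans (dist-sym w u) (≤-trans (dist≤ecc u w) eu≤r)))
    conclude (inj₂ (y , ey≡ , dyu<dcu)) =
      y , ey≡ , (λ { refl → near dyu<dcu (m≤n⇒m≤1+n (dist≤length here)) })
              , near dyu<dcu ∘ dist-adjacent

  annulus-nonNeighbour : ∀ {w} → InAnnulus G w → ∃ λ y → InAnnulus G y × NonNeighbour G w y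
  annulus-nonNeighbour {w} (r , D , e , rad , diam , e-isEcc , r<e , e<D) =
    extend (nonNeighbour-beyond-radius rad (subst (r <_) (isEcc⇒≡ecc e-isEcc) r<e))
    where
    extend : (∃ λ y → ecc y ≡ suc r × NonNeighbour G w y) →
             ∃ λ y → InAnnulus G y × NonNeighbour G w y
    extend (y , ey≡1+r , w≁y) =
      y , (r , D , ecc y , rad , diam , ecc-isEcc y , r<ey , ≤-<-trans ey≤e e<D) , w≁y
      where
      r<ey : r < ecc y
      r<ey = subst (r <_) (≡-sym ey≡1+r) (n<1+n r)
      ey≤e : ecc y ≤ e
      ey≤e = subst (_≤ e) (≡-sym ey≡1+r) r<e

module WithoutUniversalVertex {V : Set} (G : Graph V)
    (_≟_ : DecidableEquality V) (exhaustible : Exhaustible V) (connected : Connected G)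
    (nonNeighbour : ∀ x → ∃ (NonNeighbour G x)) where

  open ShortestWalks G _≟_ exhaustible

  2≤rad : ∀ {r} → IsRad G r → 2 ≤ r
  2≤rad ((v , bounded , _) , _) with nonNeighbour v
  ... | a , v≁a with shortest (proj₂ (connected v a))
  ... | d , d-isDist =
    ≤-trans (nonNeighbour⇒2≤length G v≁a (proj₁ d-isDist)) (bounded a d d-isDist)

  four-vertices : V → ∃ λ (xs : List V) → Unique xs × length xs ≡ 4
  four-vertices x with nonNeighbour x
  ... | y , x≁y with shortest (proj₂ (connected x y))
  ... | _ , L-isDist = along (proj₁ L-isDist) L-isDist
    where
    along : ∀ {L} → Walk G x y L → IsDist G x y L → ∃ λ (xs : List V) → Unique xs × length xs ≡ 4
    along here _ = ⊥-elim (proj₁ x≁y refl)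
    along (step a here) _ = ⊥-elim (proj₂ x≁y a)
    along (step {v = x′} a (step b here)) _ with nonNeighbour x′
    ... | z , x′≁z = x ∷ x′ ∷ y ∷ z ∷ [] ,
      (adjacent⇒≢ G a ∷ proj₁ x≁y ∷ (λ { refl → proj₂ x′≁z (sym G a) }) ∷ []) ∷
      (adjacent⇒≢ G b ∷ proj₁ x′≁z ∷ []) ∷
      ((λ { refl → proj₂ x′≁z b }) ∷ []) ∷ [] ∷ [] ,
      refl
    along (step {v = x′} a (step {v = y′} b (step {v = z} {k = k} c rest))) x⇝y-shortest =
      x ∷ x′ ∷ y′ ∷ z ∷ [] ,
      (adjacent⇒≢ G a ∷ (λ { refl → shortcut here (step c rest) (m≤n+m _ 1) })
                      ∷ (λ { refl → shortcut here rest (m≤n+m _ 2) }) ∷ []) ∷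
      (adjacent⇒≢ G b ∷ (λ { refl → shortcut (step a here) rest (m≤n+m _ 1) }) ∷ []) ∷
      (adjacent⇒≢ G c ∷ []) ∷ [] ∷ [] ,
      refl
      where
      shortcut : ∀ {v i j} → Walk G x v i → Walk G v y j → i + j < 3 + k → ⊥
      shortcut = shortest-no-shortcut G x⇝y-shortest

lemma4 : ∀ {n} (G : FinGraph n) → Connected G →
    (S : Subset n) → (∀ w → (w ∈ S) ⇔ InAnnulus G w) →
    Σ (Fin n) (λ x → x ∈ S) →
    Connected (Induced G S) →
    (∀ r → IsRad (Induced G S) r → 2 ≤ r) × 4 ≤ ∣ S ∣
lemma4 G connected S S⇔annulus w W-connected = (λ _ → 2≤rad) , 4≤∣S∣
  where
  W = Induced G S
  open Metric G connected using (annulus-nonNeighbour)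

  nonNeighbour : ∀ x → ∃ (NonNeighbour W x)
  nonNeighbour (x , x∈S) =
    let y , y-annular , x≢y , x≁y = annulus-nonNeighbour (Equivalence.to (S⇔annulus x) x∈S)
    in (y , Equivalence.from (S⇔annulus y) y-annular) , x≢y ∘ cong proj₁ , x≁y

  open WithoutUniversalVertex W member-≟ member-exhaustible W-connected nonNeighbour

  4≤∣S∣ : 4 ≤ ∣ S ∣
  4≤∣S∣ = let xs , unique , length≡4 = four-vertices w in
          subst (_≤ ∣ S ∣) length≡4 (members-length≤∣p∣ unique)
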